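{- Let $G$ be a finite abelian group of order $n$ and let $\epsilon > 0$. Suppose that $F \subseteq G$ has cardinality at least $(1/3 + \epsilon)n$ and that $F$ has at most $\epsilon^3 n^2/27$ Schur triples. Then there is a sum-free set $S \subseteq F$ with $|S| \geq |F| - \epsilon n$.
   Context: A Schur triple in $F$ is an ordered triple $(x,y,z) \in F^3$ with $x+y=z$. A set $S$ is sum-free if it contains no $x,y,z$ (not necessarily distinct) with $x+y=z$.
   Formalization: The parameter ε ranges over the positive rationals. -}

module Defs where

open import Level using (0ℓ)
open import Data.Nat using (ℕ)
open import Data.Fin using (Fin)
open import Data.Fin.Properties using (_≟_)
open import Data.Fin.Subset using (Subset; _∈_)
open import Data.Fin.Subset.Properties using (_∈?_)
open import Data.Product using (_×_; _,_)
open import Data.List using (List; length; filter; allFin; cartesianProduct)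
open import Relation.Nullary using (¬_)
open import Relation.Nullary.Decidable using (_×-dec_)
open import Relation.Binary.PropositionalEquality using (_≡_)
open import Algebra.Structures using (IsAbelianGroup)
open import Data.Integer using (+_)
open import Data.Rational using (ℚ; _/_)

-- A finite abelian group of order n, presented (up to isomorphism) on the
-- carrier Fin n with propositional equality.
record FiniteAbelianGroup (n : ℕ) : Set where
  infixl 6 _+_
  field
    _+_ : Fin n → Fin n → Fin n
    0# : Fin n
    -_ : Fin n → Fin n
    isAbelianGroup : IsAbelianGroup _≡_ _+_ 0# -_



schurTriples : ∀ {n} → FiniteAbelianGroup n → Subset n → ℕ
schurTriples {n} G F =
  length (filter P? (cartesianProduct (allFin n) (cartesianProduct (allFin n) (allFin n))))
  where
    P : Fin n × Fin n × Fin n → Set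
    P (x , y , z) = x ∈ F × y ∈ F × z ∈ F × FiniteAbelianGroup._+_ G x y ≡ z
    P? : (t : Fin n × Fin n × Fin n) → _
    P? (x , y , z) = (x ∈? F) ×-dec ((y ∈? F) ×-dec ((z ∈? F) ×-dec (_≟_ (FiniteAbelianGroup._+_ G x y) z)))

SumFree : ∀ {n} → FiniteAbelianGroup n → Subset n → Set
SumFree G S = ∀ x y z → x ∈ S → y ∈ S → z ∈ S → ¬ (FiniteAbelianGroup._+_ G x y ≡ z)

ℕ→ℚ : ℕ → ℚ
ℕ→ℚ k = + k / 1

-- Write r(a) = |F ∩ (F − a)| (shiftOverlap), so that the sum of r over F is at most the number T of
-- Schur triples, and call a popular when 3 r(a) ≥ 3|F| − n.  If x + y = z then F − x and F − z meet
-- in a translate of F ∩ (F − y), so inclusion–exclusion for F, F − x, F − z inside a group of order n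
-- gives 3|F| ≤ n + r(x) + r(y) + r(z): no Schur triple consists of unpopular elements, and F minus
-- its popular elements is sum-free.  Each popular a ∈ F has r(a) ≥ |F| − n/3 ≥ εn, so there are at
-- most T/(εn) ≤ ε²n/27 ≤ εn of them.
module Submission where

open import Defs

module Counting where

  open import Level using (0ℓ)
  open import Data.Bool.Base using (Bool; true; false; _∧_)
  open import Data.Bool.Properties using (∧-identityʳ)
  open import Data.Nat.Base using (ℕ; zero; suc; _+_; _*_; _≤_; _<_; z≤n)
  open import Data.Nat.Properties
    using ( module ≤-Reasoning; _≤?_; +-*-semiring; *-identityˡ; *-identityʳ; +-suc; *-distribˡ-+
          ; ≤-refl; ≤-reflexive; ≤-trans; <-irrefl; ≰⇒>; ≤ᵇ⇒≤; m≤m+n; m≤n+m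
          ; +-mono-≤; +-monoˡ-≤; +-mono-<; *-monoʳ-≤ )
  open import Data.Nat.Tactic.RingSolver using (solve-∀)
  open import Data.Fin.Base using (Fin; zero; suc)
  open import Data.Fin.Properties using (_≟_)
  open import Data.Fin.Permutation using (Permutation; permutation)
  open import Data.Fin.Subset using (Subset; _∈_; _∉_; _⊆_; _∩_; _─_; ∣_∣; inside; outside)
  open import Data.Fin.Subset.Properties using (_∈?_; p∩q⊆p; x∈p∩q⁻)
  open import Data.Vec.Base as Vec using ([]; _∷_; lookup; here; there)
  open import Data.Vec.Properties using ([]=⇒lookup; lookup⇒[]=; lookup∘tabulate)
  open import Data.List.Base using ([]; _∷_; _++_; length; filter; map; tabulate; cartesianProduct)
  open import Data.List.Properties using (length-++; filter-++)
  open import Data.Product using (_×_; _,_; proj₂)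
  open import Relation.Nullary using (¬_; yes)
  open import Relation.Nullary.Decidable using (does; dec-true; _×-dec_)
  open import Relation.Unary using (Pred; Decidable)
  open import Relation.Binary.PropositionalEquality
    using (_≡_; refl; sym; trans; cong; cong₂; module ≡-Reasoning)
  open import Algebra.Bundles using (Group)
  open import Algebra.Structures using (IsAbelianGroup)
  open import Algebra.Properties.Semiring.Sum +-*-semiring
    using (sum; sum-syntax; sum-cong-≗; sum-permute; ∑-distrib-+; *-distribˡ-sum; *-distribʳ-sum)

  𝟙 : Bool → ℕ
  𝟙 true  = 1
  𝟙 false = 0

  𝟙-∧ : ∀ a b → 𝟙 (a ∧ b) ≡ 𝟙 a * 𝟙 b
  𝟙-∧ true  b = sym (*-identityˡ (𝟙 b))
  𝟙-∧ false b = refl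

  𝟙-inclusion-exclusion : ∀ a b c →
    𝟙 a + 𝟙 b + 𝟙 c ≤ 1 + (𝟙 a * 𝟙 b + 𝟙 b * 𝟙 c + 𝟙 a * 𝟙 c)
  𝟙-inclusion-exclusion true  true  true  = ≤ᵇ⇒≤ 3 4 _
  𝟙-inclusion-exclusion true  true  false = ≤ᵇ⇒≤ 2 2 _
  𝟙-inclusion-exclusion true  false true  = ≤ᵇ⇒≤ 2 2 _
  𝟙-inclusion-exclusion true  false false = ≤ᵇ⇒≤ 1 1 _
  𝟙-inclusion-exclusion false true  true  = ≤ᵇ⇒≤ 2 2 _
  𝟙-inclusion-exclusion false true  false = ≤ᵇ⇒≤ 1 1 _
  𝟙-inclusion-exclusion false false true  = ≤ᵇ⇒≤ 1 1 _
  𝟙-inclusion-exclusion false false false = z≤n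

  3*m≡m+m+m : ∀ m → 3 * m ≡ m + m + m
  3*m≡m+m+m = solve-∀

  sum-mono-≤ : ∀ {n} {f g : Fin n → ℕ} → (∀ i → f i ≤ g i) → sum f ≤ sum g
  sum-mono-≤ {zero}  f≤g = z≤n
  sum-mono-≤ {suc n} f≤g = +-mono-≤ (f≤g zero) (sum-mono-≤ (λ i → f≤g (suc i)))

  sum-const : ∀ n c → ∑[ i < n ] c ≡ n * c
  sum-const zero    c = refl
  sum-const (suc n) c = cong (c +_) (sum-const n c)

  term≤sum : ∀ {n} (f : Fin n → ℕ) i → f i ≤ sum f
  term≤sum f zero    = m≤m+n _ _
  term≤sum f (suc i) = ≤-trans (term≤sum (λ j → f (suc j)) i) (m≤n+m _ _)

  does-∈? : ∀ {n} (x : Fin n) (p : Subset n) → does (x ∈? p) ≡ lookup p x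
  does-∈? zero    (inside  ∷ p) = refl
  does-∈? zero    (outside ∷ p) = refl
  does-∈? (suc x) (s ∷ p)       = does-∈? x p

  ∣p∣≡∑𝟙 : ∀ {n} (p : Subset n) → ∣ p ∣ ≡ ∑[ i < n ] 𝟙 (lookup p i)
  ∣p∣≡∑𝟙 []            = refl
  ∣p∣≡∑𝟙 (inside  ∷ p) = cong suc (∣p∣≡∑𝟙 p)
  ∣p∣≡∑𝟙 (outside ∷ p) = ∣p∣≡∑𝟙 p

  ∣p∣≡∣p─q∣+∣p∩q∣ : ∀ {n} (p q : Subset n) → ∣ p ∣ ≡ ∣ p ─ q ∣ + ∣ p ∩ q ∣
  ∣p∣≡∣p─q∣+∣p∩q∣ []            []            = refl
  ∣p∣≡∣p─q∣+∣p∩q∣ (inside  ∷ p) (inside  ∷ q) =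
    trans (cong suc (∣p∣≡∣p─q∣+∣p∩q∣ p q)) (sym (+-suc ∣ p ─ q ∣ ∣ p ∩ q ∣))
  ∣p∣≡∣p─q∣+∣p∩q∣ (inside  ∷ p) (outside ∷ q) = cong suc (∣p∣≡∣p─q∣+∣p∩q∣ p q)
  ∣p∣≡∣p─q∣+∣p∩q∣ (outside ∷ p) (inside  ∷ q) = ∣p∣≡∣p─q∣+∣p∩q∣ p q
  ∣p∣≡∣p─q∣+∣p∩q∣ (outside ∷ p) (outside ∷ q) = ∣p∣≡∣p─q∣+∣p∩q∣ p q

  x∈p─q⇒x∉q : ∀ {n} {x : Fin n} (p q : Subset n) → x ∈ p ─ q → x ∉ q
  x∈p─q⇒x∉q (s ∷ p) (outside ∷ q) here          ()
  x∈p─q⇒x∉q (s ∷ p) (t       ∷ q) (there x∈p─q) (there x∈q) = x∈p─q⇒x∉q p q x∈p─q x∈q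

  module _ {n} {P : Pred (Fin n) 0ℓ} (P? : Decidable P) where

    subsetOf : Subset n
    subsetOf = Vec.tabulate (λ i → does (P? i))

    ∈-subsetOf⁻ : ∀ {x} → x ∈ subsetOf → P x
    ∈-subsetOf⁻ {x} x∈ with P? x | trans (sym (lookup∘tabulate _ x)) ([]=⇒lookup x∈)
    ... | yes Px | _ = Px

    ∉-subsetOf⁻ : ∀ {x} → x ∉ subsetOf → ¬ P x
    ∉-subsetOf⁻ {x} x∉ Px = x∉ (lookup⇒[]= x subsetOf (trans (lookup∘tabulate _ x) (dec-true (P? x) Px)))

  sumOver : ∀ {n} → Subset n → (Fin n → ℕ) → ℕ
  sumOver {n} p f = ∑[ i < n ] (𝟙 (lookup p i) * f i)

  syntax sumOver p (λ i → e) = ∑[ i ∈ p ] e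

  module _ {n} (p : Subset n) where

    sumOver-const : ∀ c → ∑[ i ∈ p ] c ≡ ∣ p ∣ * c
    sumOver-const c = begin
      ∑[ i < n ] (𝟙 (lookup p i) * c) ≡⟨ *-distribʳ-sum c (λ i → 𝟙 (lookup p i)) ⟨
      (∑[ i < n ] 𝟙 (lookup p i)) * c ≡⟨ cong (_* c) (∣p∣≡∑𝟙 p) ⟨
      ∣ p ∣ * c                        ∎
      where open ≡-Reasoning

    sumOver-+ : ∀ (f g : Fin n → ℕ) → ∑[ i ∈ p ] (f i + g i) ≡ sumOver p f + sumOver p g
    sumOver-+ f g = trans (sum-cong-≗ (λ i → *-distribˡ-+ (𝟙 (lookup p i)) (f i) (g i)))
                          (∑-distrib-+ (λ i → 𝟙 (lookup p i) * f i) (λ i → 𝟙 (lookup p i) * g i))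

    sumOver-*ˡ : ∀ c (f : Fin n → ℕ) → ∑[ i ∈ p ] (c * f i) ≡ c * sumOver p f
    sumOver-*ˡ c f = trans (sum-cong-≗ (λ i → x*[c*y]≡c*[x*y] (𝟙 (lookup p i)) c (f i)))
                           (sym (*-distribˡ-sum c (λ i → 𝟙 (lookup p i) * f i)))
      where
      x*[c*y]≡c*[x*y] : ∀ x c y → x * (c * y) ≡ c * (x * y)
      x*[c*y]≡c*[x*y] = solve-∀

    sumOver-mono-≤ : ∀ {f g : Fin n → ℕ} → (∀ i → i ∈ p → f i ≤ g i) → sumOver p f ≤ sumOver p g
    sumOver-mono-≤ {f} {g} f≤g = sum-mono-≤ pointwise
      where
      pointwise : ∀ i → 𝟙 (lookup p i) * f i ≤ 𝟙 (lookup p i) * g i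
      pointwise i with lookup p i in eq
      ... | true  = *-monoʳ-≤ 1 (f≤g i (lookup⇒[]= i p eq))
      ... | false = z≤n

    sumOver-mono-⊆ : ∀ {q} (f : Fin n → ℕ) → p ⊆ q → sumOver p f ≤ sumOver q f
    sumOver-mono-⊆ {q} f p⊆q = sum-mono-≤ pointwise
      where
      pointwise : ∀ i → 𝟙 (lookup p i) * f i ≤ 𝟙 (lookup q i) * f i
      pointwise i with lookup p i in eq
      ... | true  rewrite []=⇒lookup (p⊆q (lookup⇒[]= i p eq)) = ≤-refl
      ... | false = z≤n

  module _ {A : Set} {P : Pred A 0ℓ} (P? : Decidable P) where

    length-filter-++ : ∀ xs ys → length (filter P? (xs ++ ys)) ≡ length (filter P? xs) + length (filter P? ys)
    length-filter-++ xs ys = trans (cong length (filter-++ P? xs ys)) (length-++ (filter P? xs))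

    length-filter-tabulate : ∀ {n} (f : Fin n → A) → length (filter P? (tabulate f)) ≡ ∑[ i < n ] 𝟙 (does (P? (f i)))
    length-filter-tabulate {zero}  f = refl
    length-filter-tabulate {suc n} f with does (P? (f zero))
    ... | true  = cong suc (length-filter-tabulate (λ i → f (suc i)))
    ... | false = length-filter-tabulate (λ i → f (suc i))

    length-filter-map : ∀ {B : Set} (g : B → A) xs → length (filter P? (map g xs)) ≡ length (filter (λ x → P? (g x)) xs)
    length-filter-map g []       = refl
    length-filter-map g (x ∷ xs) with does (P? (g x))
    ... | true  = cong suc (length-filter-map g xs)
    ... | false = length-filter-map g xs

  module _ {A B : Set} {P : Pred (A × B) 0ℓ} (P? : Decidable P) where

    length-filter-cartesianProduct : ∀ {n} (f : Fin n → A) ys →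
      length (filter P? (cartesianProduct (tabulate f) ys)) ≡ ∑[ i < n ] length (filter (λ y → P? (f i , y)) ys)
    length-filter-cartesianProduct {zero}  f ys = refl
    length-filter-cartesianProduct {suc n} f ys = begin
      length (filter P? (map (f zero ,_) ys ++ cartesianProduct (tabulate (λ i → f (suc i))) ys))
        ≡⟨ length-filter-++ P? (map (f zero ,_) ys) _ ⟩
      length (filter P? (map (f zero ,_) ys)) + length (filter P? (cartesianProduct (tabulate (λ i → f (suc i))) ys))
        ≡⟨ cong₂ _+_ (length-filter-map P? (f zero ,_) ys) (length-filter-cartesianProduct (λ i → f (suc i)) ys) ⟩
      length (filter (λ y → P? (f zero , y)) ys) + ∑[ i < n ] length (filter (λ y → P? (f (suc i) , y)) ys)
        ∎
      where open ≡-Reasoning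

  module _ {n} (G : FiniteAbelianGroup n) where
    open FiniteAbelianGroup G using (isAbelianGroup) renaming (_+_ to _⊕_; -_ to ⊖_)
    open IsAbelianGroup isAbelianGroup using (isGroup)

    asGroup : Group 0ℓ 0ℓ
    asGroup = record { isGroup = isGroup }

    open import Algebra.Properties.Group asGroup using (\\-leftDividesˡ; \\-leftDividesʳ)

    translation : Fin n → Permutation n n
    translation a = permutation (a ⊕_) (⊖ a ⊕_) (\\-leftDividesˡ a) (\\-leftDividesʳ a)

    sum-translate : ∀ a (f : Fin n → ℕ) → ∑[ w < n ] f (a ⊕ w) ≡ sum f
    sum-translate a f = sym (sum-permute f (translation a))

  module _ {n} (G : FiniteAbelianGroup n) (F : Subset n) where
    open FiniteAbelianGroup G using (isAbelianGroup) renaming (_+_ to _⊕_)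
    open IsAbelianGroup isAbelianGroup using (assoc; comm)

    χ : Fin n → ℕ
    χ i = 𝟙 (lookup F i)

    shiftOverlap : Fin n → ℕ
    shiftOverlap a = ∑[ w ∈ F ] χ (a ⊕ w)

    IsSchurTriple : Pred (Fin n × Fin n × Fin n) 0ℓ
    IsSchurTriple (x , y , z) = x ∈ F × y ∈ F × z ∈ F × x ⊕ y ≡ z

    -- The procedure filtered in schurTriples itself, so schurTriples≡∑ holds by unfolding.
    isSchurTriple? : Decidable IsSchurTriple
    isSchurTriple? (x , y , z) = (x ∈? F) ×-dec ((y ∈? F) ×-dec ((z ∈? F) ×-dec (x ⊕ y ≟ z)))

    schurTriples≡∑ : schurTriples G F ≡ ∑[ x < n ] ∑[ y < n ] ∑[ z < n ] 𝟙 (does (isSchurTriple? (x , y , z)))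
    schurTriples≡∑ = trans (length-filter-cartesianProduct isSchurTriple? (λ x → x) _) (sum-cong-≗ λ x →
      trans (length-filter-cartesianProduct (λ p → isSchurTriple? (x , p)) (λ y → y) _) (sum-cong-≗ λ y →
        length-filter-tabulate (λ z → isSchurTriple? (x , y , z)) (λ z → z)))

    𝟙-isSchurTriple : ∀ x y → 𝟙 (does (isSchurTriple? (x , y , x ⊕ y))) ≡ χ x * (χ y * χ (x ⊕ y))
    𝟙-isSchurTriple x y
      rewrite dec-true (x ⊕ y ≟ x ⊕ y) refl | ∧-identityʳ (does (x ⊕ y ∈? F))
            | does-∈? x F | does-∈? y F | does-∈? (x ⊕ y) F
      = trans (𝟙-∧ (lookup F x) _) (cong (χ x *_) (𝟙-∧ (lookup F y) _))

    ∑shiftOverlap≤schurTriples : ∑[ x ∈ F ] shiftOverlap x ≤ schurTriples G F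
    ∑shiftOverlap≤schurTriples = begin
      ∑[ x < n ] (χ x * ∑[ y < n ] (χ y * χ (x ⊕ y)))
        ≡⟨ sum-cong-≗ (λ x → *-distribˡ-sum (χ x) (λ y → χ y * χ (x ⊕ y))) ⟩
      ∑[ x < n ] ∑[ y < n ] (χ x * (χ y * χ (x ⊕ y)))
        ≤⟨ sum-mono-≤ (λ x → sum-mono-≤ (λ y →
             ≤-trans (≤-reflexive (sym (𝟙-isSchurTriple x y)))
                     (term≤sum (λ z → 𝟙 (does (isSchurTriple? (x , y , z)))) (x ⊕ y)))) ⟩
      ∑[ x < n ] ∑[ y < n ] ∑[ z < n ] 𝟙 (does (isSchurTriple? (x , y , z)))
        ≡⟨ schurTriples≡∑ ⟨
      schurTriples G F ∎
      where open ≤-Reasoning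

    shiftOverlap-inclusion-exclusion : ∀ {x y z} → x ⊕ y ≡ z →
      3 * ∣ F ∣ ≤ n + (shiftOverlap x + shiftOverlap y + shiftOverlap z)
    shiftOverlap-inclusion-exclusion {x} {y} {z} x⊕y≡z = begin
      3 * ∣ F ∣                        ≡⟨ 3*m≡m+m+m ∣ F ∣ ⟩
      ∣ F ∣ + ∣ F ∣ + ∣ F ∣            ≡⟨ cong₂ _+_ (cong₂ _+_ ∣F∣≡∑A ∣F∣≡∑B) ∣F∣≡∑C ⟩
      sum A + sum B + sum C           ≡⟨ cong (_+ sum C) (∑-distrib-+ A B) ⟨
      sum (λ w → A w + B w) + sum C   ≡⟨ ∑-distrib-+ (λ w → A w + B w) C ⟨
      ∑[ w < n ] (A w + B w + C w)    ≤⟨ sum-mono-≤ (λ w → 𝟙-inclusion-exclusion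
                                           (lookup F w) (lookup F (x ⊕ w)) (lookup F (z ⊕ w))) ⟩
      ∑[ w < n ] (1 + (AB w + BC w + AC w))
        ≡⟨ ∑-distrib-+ (λ _ → 1) (λ w → AB w + BC w + AC w) ⟩
      ∑[ w < n ] 1 + sum (λ w → AB w + BC w + AC w)
        ≡⟨ cong₂ _+_ (trans (sum-const n 1) (*-identityʳ n))
                     (trans (∑-distrib-+ (λ w → AB w + BC w) AC) (cong (_+ sum AC) (∑-distrib-+ AB BC))) ⟩
      n + (sum AB + sum BC + sum AC)   ≡⟨ cong (λ s → n + (sum AB + s + sum AC)) ∑BC≡shiftOverlap ⟩
      n + (shiftOverlap x + shiftOverlap y + shiftOverlap z) ∎
      where
      open ≤-Reasoning
      A B C AB BC AC : Fin n → ℕ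
      A w = χ w
      B w = χ (x ⊕ w)
      C w = χ (z ⊕ w)
      AB w = A w * B w
      BC w = B w * C w
      AC w = A w * C w
      ∣F∣≡∑A : ∣ F ∣ ≡ sum A
      ∣F∣≡∑A = ∣p∣≡∑𝟙 F
      ∣F∣≡∑B : ∣ F ∣ ≡ sum B
      ∣F∣≡∑B = trans ∣F∣≡∑A (sym (sum-translate G x A))
      ∣F∣≡∑C : ∣ F ∣ ≡ sum C
      ∣F∣≡∑C = trans ∣F∣≡∑A (sym (sum-translate G z A))
      y⊕[x⊕w]≡z⊕w : ∀ w → y ⊕ (x ⊕ w) ≡ z ⊕ w
      y⊕[x⊕w]≡z⊕w w = trans (sym (assoc y x w)) (cong (_⊕ w) (trans (comm y x) x⊕y≡z))
      ∑BC≡shiftOverlap : sum BC ≡ shiftOverlap y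
      ∑BC≡shiftOverlap = trans (sum-cong-≗ (λ w → cong (λ u → B w * χ u) (sym (y⊕[x⊕w]≡z⊕w w))))
                               (sum-translate G x (λ u → χ u * χ (y ⊕ u)))

    Popular : Pred (Fin n) 0ℓ
    Popular a = 3 * ∣ F ∣ ≤ 3 * shiftOverlap a + n

    popular? : Decidable Popular
    popular? a = 3 * ∣ F ∣ ≤? 3 * shiftOverlap a + n

    popular : Subset n
    popular = subsetOf popular?

    F─popular-sumFree : SumFree G (F ─ popular)
    F─popular-sumFree x y z x∈ y∈ z∈ x⊕y≡z = <-irrefl refl (begin-strict
      3 * (3 * ∣ F ∣)                        ≤⟨ *-monoʳ-≤ 3 (shiftOverlap-inclusion-exclusion x⊕y≡z) ⟩
      3 * (n + (ox + oy + oz))               ≡⟨ regroup n ox oy oz ⟩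
      (3 * ox + n) + (3 * oy + n) + (3 * oz + n)
        <⟨ +-mono-< (+-mono-< (unpopular x∈) (unpopular y∈)) (unpopular z∈) ⟩
      3 * ∣ F ∣ + 3 * ∣ F ∣ + 3 * ∣ F ∣      ≡⟨ 3*m≡m+m+m (3 * ∣ F ∣) ⟨
      3 * (3 * ∣ F ∣)                        ∎)
      where
      open ≤-Reasoning
      ox = shiftOverlap x
      oy = shiftOverlap y
      oz = shiftOverlap z
      unpopular : ∀ {a} → a ∈ F ─ popular → 3 * shiftOverlap a + n < 3 * ∣ F ∣
      unpopular a∈ = ≰⇒> (∉-subsetOf⁻ popular? (x∈p─q⇒x∉q F popular a∈))
      regroup : ∀ n a b c → 3 * (n + (a + b + c)) ≡ (3 * a + n) + (3 * b + n) + (3 * c + n)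
      regroup = solve-∀

    ∣F∩popular∣-bound : ∣ F ∩ popular ∣ * (3 * ∣ F ∣) ≤ 3 * schurTriples G F + ∣ F ∩ popular ∣ * n
    ∣F∩popular∣-bound = begin
      ∣ D ∣ * (3 * ∣ F ∣)                                    ≡⟨ sumOver-const D (3 * ∣ F ∣) ⟨
      ∑[ a ∈ D ] (3 * ∣ F ∣)                                 ≤⟨ sumOver-mono-≤ D (λ a a∈D → isPopular a∈D) ⟩
      ∑[ a ∈ D ] (3 * shiftOverlap a + n)                    ≡⟨ sumOver-+ D (λ a → 3 * shiftOverlap a) (λ _ → n) ⟩
      ∑[ a ∈ D ] (3 * shiftOverlap a) + ∑[ a ∈ D ] n         ≡⟨ cong₂ _+_ (sumOver-*ˡ D 3 shiftOverlap) (sumOver-const D n) ⟩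
      3 * ∑[ a ∈ D ] shiftOverlap a + ∣ D ∣ * n              ≤⟨ +-monoˡ-≤ _ (*-monoʳ-≤ 3 (sumOver-mono-⊆ D shiftOverlap (p∩q⊆p F popular))) ⟩
      3 * ∑[ a ∈ F ] shiftOverlap a + ∣ D ∣ * n              ≤⟨ +-monoˡ-≤ _ (*-monoʳ-≤ 3 ∑shiftOverlap≤schurTriples) ⟩
      3 * schurTriples G F + ∣ D ∣ * n                       ∎
      where
      open ≤-Reasoning
      D = F ∩ popular
      isPopular : ∀ {a} → a ∈ D → Popular a
      isPopular a∈D = ∈-subsetOf⁻ popular? (proj₂ (x∈p∩q⁻ F popular a∈D))

module Estimate where

  open import Data.Nat.Base as ℕ using (ℕ; z≤n; s≤s)
  open import Data.Integer.Base as ℤ using (+_)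
  import Data.Integer.Properties as ℤ
  open import Data.Rational.Base
  open import Data.Rational.Properties
  open import Data.Rational.Solver using (module +-*-Solver)
  open import Data.Rational.Unnormalised.Base as ℚᵘ using (ℚᵘ; mkℚᵘ; *≡*; *≤*)
  import Data.Rational.Unnormalised.Properties as ℚᵘ
  open import Relation.Nullary using (yes; no)
  open import Relation.Binary.PropositionalEquality using (_≡_; refl; sym; trans; cong; cong₂)
  open +-*-Solver

  private
    ℕ→ℚᵘ : ℕ → ℚᵘ
    ℕ→ℚᵘ k = mkℚᵘ (+ k) 0

    toℚᵘ-ℕ→ℚ : ∀ k → toℚᵘ (ℕ→ℚ k) ℚᵘ.≃ ℕ→ℚᵘ k
    toℚᵘ-ℕ→ℚ k = toℚᵘ-fromℚᵘ (ℕ→ℚᵘ k)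

  ℕ→ℚ-+ : ∀ a b → ℕ→ℚ (a ℕ.+ b) ≡ ℕ→ℚ a + ℕ→ℚ b
  ℕ→ℚ-+ a b = toℚᵘ-injective (begin
    toℚᵘ (ℕ→ℚ (a ℕ.+ b))             ≈⟨ toℚᵘ-ℕ→ℚ (a ℕ.+ b) ⟩
    ℕ→ℚᵘ (a ℕ.+ b)                   ≈⟨ *≡* (cong (ℤ._* + 1) +[a+b]≡+a*1++b*1) ⟩
    ℕ→ℚᵘ a ℚᵘ.+ ℕ→ℚᵘ b               ≈⟨ ℚᵘ.+-cong (toℚᵘ-ℕ→ℚ a) (toℚᵘ-ℕ→ℚ b) ⟨
    toℚᵘ (ℕ→ℚ a) ℚᵘ.+ toℚᵘ (ℕ→ℚ b)   ≈⟨ toℚᵘ-homo-+ (ℕ→ℚ a) (ℕ→ℚ b) ⟨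
    toℚᵘ (ℕ→ℚ a + ℕ→ℚ b)             ∎)
    where
    open ℚᵘ.≃-Reasoning
    +[a+b]≡+a*1++b*1 : + (a ℕ.+ b) ≡ + a ℤ.* + 1 ℤ.+ + b ℤ.* + 1
    +[a+b]≡+a*1++b*1 = trans (ℤ.pos-+ a b) (sym (cong₂ ℤ._+_ (ℤ.*-identityʳ (+ a)) (ℤ.*-identityʳ (+ b))))

  ℕ→ℚ-* : ∀ a b → ℕ→ℚ (a ℕ.* b) ≡ ℕ→ℚ a * ℕ→ℚ b
  ℕ→ℚ-* a b = toℚᵘ-injective (begin
    toℚᵘ (ℕ→ℚ (a ℕ.* b))             ≈⟨ toℚᵘ-ℕ→ℚ (a ℕ.* b) ⟩
    ℕ→ℚᵘ (a ℕ.* b)                   ≈⟨ *≡* (cong (ℤ._* + 1) (ℤ.pos-* a b)) ⟩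
    ℕ→ℚᵘ a ℚᵘ.* ℕ→ℚᵘ b               ≈⟨ ℚᵘ.*-cong (toℚᵘ-ℕ→ℚ a) (toℚᵘ-ℕ→ℚ b) ⟨
    toℚᵘ (ℕ→ℚ a) ℚᵘ.* toℚᵘ (ℕ→ℚ b)   ≈⟨ toℚᵘ-homo-* (ℕ→ℚ a) (ℕ→ℚ b) ⟨
    toℚᵘ (ℕ→ℚ a * ℕ→ℚ b)             ∎)
    where open ℚᵘ.≃-Reasoning

  ℕ→ℚ-mono-≤ : ∀ {a b} → a ℕ.≤ b → ℕ→ℚ a ≤ ℕ→ℚ b
  ℕ→ℚ-mono-≤ {a} {b} a≤b = toℚᵘ-cancel-≤ (begin
    toℚᵘ (ℕ→ℚ a) ≃⟨ toℚᵘ-ℕ→ℚ a ⟩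
    ℕ→ℚᵘ a       ≤⟨ *≤* (ℤ.*-monoʳ-≤-nonNeg (+ 1) (ℤ.+≤+ a≤b)) ⟩
    ℕ→ℚᵘ b       ≃⟨ toℚᵘ-ℕ→ℚ b ⟨
    toℚᵘ (ℕ→ℚ b) ∎)
    where open ℚᵘ.≤-Reasoning


  +-cancelˡ-≤ : ∀ {p q r} → p + q ≤ p + r → q ≤ r
  +-cancelˡ-≤ {p} {q} {r} p+q≤p+r = begin
    q             ≡⟨ solve 2 (λ p q → q := (:- p) :+ (p :+ q)) refl p q ⟩
    - p + (p + q) ≤⟨ +-monoʳ-≤ (- p) p+q≤p+r ⟩
    - p + (p + r) ≡⟨ solve 2 (λ p r → (:- p) :+ (p :+ r) := r) refl p r ⟩
    r             ∎
    where open ≤-Reasoning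

  popular-triples-bound : ∀ {ε N K D T} → 0ℚ ≤ D →
    (+ 1 / 3 + ε) * N ≤ K →
    D * (+ 3 / 1 * K) ≤ + 3 / 1 * T + D * N →
    D * (+ 3 / 1 * (ε * N)) ≤ + 3 / 1 * T
  popular-triples-bound {ε} {N} {K} {D} {T} 0≤D dense counting = +-cancelˡ-≤ {D * N} (begin
    D * N + D * (+ 3 / 1 * (ε * N))  ≡⟨ solve 3 (λ D N y → D :* N :+ D :* y := D :* (N :+ y)) refl D N _ ⟩
    D * (N + + 3 / 1 * (ε * N))      ≤⟨ *-monoˡ-≤-nonNeg D {{nonNegative 0≤D}} N+3εN≤3K ⟩
    D * (+ 3 / 1 * K)                ≤⟨ counting ⟩
    + 3 / 1 * T + D * N              ≡⟨ +-comm (+ 3 / 1 * T) (D * N) ⟩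
    D * N + + 3 / 1 * T              ∎)
    where
    open ≤-Reasoning
    N+3εN≤3K : N + + 3 / 1 * (ε * N) ≤ + 3 / 1 * K
    N+3εN≤3K = begin
      N + + 3 / 1 * (ε * N)          ≡⟨ solve 2 (λ ε N → N :+ con (+ 3 / 1) :* (ε :* N)
                                          := con (+ 3 / 1) :* ((con (+ 1 / 3) :+ ε) :* N)) refl ε N ⟩
      + 3 / 1 * ((+ 1 / 3 + ε) * N)  ≤⟨ *-monoˡ-≤-nonNeg (+ 3 / 1) dense ⟩
      + 3 / 1 * K                    ∎

  εN≤N : ∀ {ε N K} → 0ℚ ≤ N → (+ 1 / 3 + ε) * N ≤ K → K ≤ N → ε * N ≤ N
  εN≤N {ε} {N} {K} 0≤N dense K≤N = begin
    ε * N             ≡⟨ cong (_* N) (+-identityˡ ε) ⟨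
    (0ℚ + ε) * N      ≤⟨ *-monoʳ-≤-nonNeg N {{nonNegative 0≤N}} (+-monoˡ-≤ ε {0ℚ} {+ 1 / 3} (*≤* (ℤ.+≤+ z≤n))) ⟩
    (+ 1 / 3 + ε) * N ≤⟨ dense ⟩
    K                 ≤⟨ K≤N ⟩
    N                 ∎
    where open ≤-Reasoning

  popular-density-bound-pos : ∀ {ε N K D T} → 0ℚ < ε → 0ℚ < N → 0ℚ ≤ D → K ≤ N →
    (+ 1 / 3 + ε) * N ≤ K →
    T ≤ (ε * ε * ε * N * N) * (+ 1 / 27) →
    D * (+ 3 / 1 * K) ≤ + 3 / 1 * T + D * N →
    D ≤ ε * N
  popular-density-bound-pos {ε} {N} {K} {D} {T} 0<ε 0<N 0≤D K≤N dense sparse counting =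
    *-cancelʳ-≤-pos (+ 3 / 1 * x) (begin
      D * (+ 3 / 1 * x)
        ≤⟨ popular-triples-bound {ε} {N} {T = T} 0≤D dense counting ⟩
      + 3 / 1 * T
        ≤⟨ *-monoˡ-≤-nonNeg (+ 3 / 1) sparse ⟩
      + 3 / 1 * ((ε * ε * ε * N * N) * (+ 1 / 27))
        ≡⟨ regroup ⟩
      (ε * x) * (+ 1 / 9 * x)
        ≤⟨ *-monoʳ-≤-nonNeg (+ 1 / 9 * x) εx≤x ⟩
      x * (+ 1 / 9 * x)
        ≤⟨ *-monoˡ-≤-nonNeg x (*-monoʳ-≤-nonNeg x 1/9≤3) ⟩
      x * (+ 3 / 1 * x) ∎)
    where
    open ≤-Reasoning
    x = ε * N
    instance
      _ : Positive x
      _ = pos*pos⇒pos ε {{positive 0<ε}} N {{positive 0<N}}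
      _ : Positive (+ 3 / 1 * x)
      _ = pos*pos⇒pos (+ 3 / 1) x
      _ : NonNegative x
      _ = pos⇒nonNeg x
      _ : NonNegative (+ 1 / 9 * x)
      _ = pos⇒nonNeg (+ 1 / 9 * x) {{pos*pos⇒pos (+ 1 / 9) x}}
    regroup : + 3 / 1 * ((ε * ε * ε * N * N) * (+ 1 / 27)) ≡ (ε * x) * (+ 1 / 9 * x)
    regroup = solve 2 (λ ε N → con (+ 3 / 1) :* ((ε :* ε :* ε :* N :* N) :* con (+ 1 / 27))
                            := (ε :* (ε :* N)) :* (con (+ 1 / 9) :* (ε :* N))) refl ε N
    εx≤x : ε * x ≤ x
    εx≤x = *-monoˡ-≤-nonNeg ε {{pos⇒nonNeg ε {{positive 0<ε}}}} (εN≤N {ε} (<⇒≤ 0<N) dense K≤N)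
    1/9≤3 : + 1 / 9 ≤ + 3 / 1
    1/9≤3 = *≤* (ℤ.+≤+ (s≤s z≤n))

  popular-density-bound : ∀ {ε N K D T} → 0ℚ < ε → 0ℚ ≤ D → D ≤ K → K ≤ N →
    (+ 1 / 3 + ε) * N ≤ K →
    T ≤ (ε * ε * ε * N * N) * (+ 1 / 27) →
    D * (+ 3 / 1 * K) ≤ + 3 / 1 * T + D * N →
    D ≤ ε * N
  popular-density-bound {ε} {N} {D = D} 0<ε 0≤D D≤K K≤N with 0ℚ <? N
  ... | yes 0<N = popular-density-bound-pos 0<ε 0<N 0≤D K≤N
  ... | no  0≮N = λ _ _ _ → begin
    D       ≤⟨ D≤N ⟩
    N       ≤⟨ ≮⇒≥ 0≮N ⟩
    0ℚ      ≡⟨ *-zeroʳ ε ⟨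
    ε * 0ℚ  ≤⟨ *-monoˡ-≤-nonNeg ε {{pos⇒nonNeg ε {{positive 0<ε}}}} (≤-trans 0≤D D≤N) ⟩
    ε * N   ∎
    where
    open ≤-Reasoning
    D≤N = ≤-trans D≤K K≤N

  p+q-r≤p : ∀ {p q r} → q ≤ r → p + q - r ≤ p
  p+q-r≤p {p} {q} {r} q≤r = begin
    p + q - r ≤⟨ +-monoˡ-≤ (- r) (+-monoʳ-≤ p q≤r) ⟩
    p + r - r ≡⟨ solve 2 (λ p r → p :+ r :- r := p) refl p r ⟩
    p         ∎
    where open ≤-Reasoning

open Counting
open Estimate

open import Data.Nat as ℕ using (ℕ; z≤n)
open import Data.Fin.Subset using (Subset; _⊆_; _∩_; _─_; ∣_∣)
open import Data.Fin.Subset.Properties using (∣p∣≤n; ∣p∩q∣≤∣p∣; p─q⊆p)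
open import Data.Product using (Σ; _×_; _,_)
open import Data.Integer using (+_)
open import Data.Rational using (ℚ; 0ℚ; _<_; _≤_; _+_; _-_; _*_; _/_)
open import Data.Rational.Properties using (module ≤-Reasoning)
open import Relation.Binary.PropositionalEquality using (trans; cong; cong₂; subst₂)

lemma4p2 : (n : ℕ) (G : FiniteAbelianGroup n) (ε : ℚ) → 0ℚ < ε →
    (F : Subset n) →
    ((+ 1 / 3) + ε) * ℕ→ℚ n ≤ ℕ→ℚ ∣ F ∣ →
    ℕ→ℚ (schurTriples G F) ≤ (ε * ε * ε * ℕ→ℚ n * ℕ→ℚ n) * (+ 1 / 27) →
    Σ (Subset n) (λ S → S ⊆ F × SumFree G S × ℕ→ℚ ∣ F ∣ - ε * ℕ→ℚ n ≤ ℕ→ℚ ∣ S ∣)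
lemma4p2 n G ε 0<ε F dense sparse =
  S , p─q⊆p F (popular G F) , F─popular-sumFree G F , ∣F∣-εn≤∣S∣
  where
  S D : Subset n
  S = F ─ popular G F
  D = F ∩ popular G F
  counting : ℕ→ℚ ∣ D ∣ * (+ 3 / 1 * ℕ→ℚ ∣ F ∣) ≤ + 3 / 1 * ℕ→ℚ (schurTriples G F) + ℕ→ℚ ∣ D ∣ * ℕ→ℚ n
  counting = subst₂ _≤_ (trans (ℕ→ℚ-* ∣ D ∣ (3 ℕ.* ∣ F ∣)) (cong (ℕ→ℚ ∣ D ∣ *_) (ℕ→ℚ-* 3 ∣ F ∣)))
                        (trans (ℕ→ℚ-+ (3 ℕ.* schurTriples G F) (∣ D ∣ ℕ.* n))
                               (cong₂ _+_ (ℕ→ℚ-* 3 (schurTriples G F)) (ℕ→ℚ-* ∣ D ∣ n)))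
                        (ℕ→ℚ-mono-≤ (∣F∩popular∣-bound G F))
  ∣D∣≤εn : ℕ→ℚ ∣ D ∣ ≤ ε * ℕ→ℚ n
  ∣D∣≤εn = popular-density-bound 0<ε (ℕ→ℚ-mono-≤ (z≤n {∣ D ∣}))
             (ℕ→ℚ-mono-≤ (∣p∩q∣≤∣p∣ F (popular G F))) (ℕ→ℚ-mono-≤ (∣p∣≤n F)) dense sparse counting
  ∣F∣-εn≤∣S∣ : ℕ→ℚ ∣ F ∣ - ε * ℕ→ℚ n ≤ ℕ→ℚ ∣ S ∣
  ∣F∣-εn≤∣S∣ = begin
    ℕ→ℚ ∣ F ∣ - ε * ℕ→ℚ n
      ≡⟨ cong (_- (ε * ℕ→ℚ n)) (trans (cong ℕ→ℚ (∣p∣≡∣p─q∣+∣p∩q∣ F (popular G F))) (ℕ→ℚ-+ ∣ S ∣ ∣ D ∣)) ⟩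
    (ℕ→ℚ ∣ S ∣) + (ℕ→ℚ ∣ D ∣) - ε * ℕ→ℚ n
      ≤⟨ p+q-r≤p ∣D∣≤εn ⟩
    ℕ→ℚ ∣ S ∣ ∎
    where open ≤-Reasoning
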